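{- Consider an open shop system in which every machine has capacity $1$, and its corresponding edge-colored multigraph $G$. The following are equivalent: (i) $G$ contains a simple cycle whose edges have pairwise distinct colors; (ii) the system can reach a deadlock (starting from the initial state $0$).
   Context: An open shop system consists of $n$ jobs $J_1,\ldots,J_n$ and $m$ machines $M_1,\ldots,M_m$. Each job $J_j$ has a set $\mathcal{M}(J_j)\subseteq\{M_1,\ldots,M_m\}$ of machines on which it must be processed, in an arbitrary order; each machine $M_i$ has a positive integer capacity $\mathrm{cap}(M_i)$. There are two artificial machines $M_0$ and $M_{m+1}$ of unbounded capacity. A state $s$ specifies for every job $J_j$ a machine $M^s(J_j)\in\{M_0,\ldots,M_{m+1}\}$ on which it currently sits and a set $\mathcal{M}^s(J_j)\subseteq\mathcal{M}(J_j)\setminus\{M^s(J_j)\}$ of machines on which it still needs processing; each machine $M_i$, $1\le i\le m$, holds at most $\mathrm{cap}(M_i)$ jobs. The initial state $0$ has $M^0(J_j)=M_0$, $\mathcal{M}^0(J_j)=\mathcal{M}(J_j)$; the final state $f$ has $M^f(J_j)=M_{m+1}$, $\mathcal{M}^f(J_j)=\emptyset$ for all $j$. A successor of $s$ arises by moving a single job $J_j$ from $M^s(J_j)$ to a machine $M\in\mathcal{M}^s(J_j)$ holding fewer than $\mathrm{cap}(M)$ jobs (removing $M$ from its remaining set), or by moving a job with $\mathcal{M}^s(J_j)=\emptyset$, $M^s(J_j)\ne M_{m+1}$ to $M_{m+1}$. A deadlock is a state other than $f$ with no successor; reaching means via finitely many successor steps. The edge-colored multigraph $G$ of the system has vertex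 set $\{M_1,\ldots,M_m\}$; for each job $J_j$ it contains an edge of color $c_j$ between every pair of distinct machines in $\mathcal{M}(J_j)$ (a clique on $\mathcal{M}(J_j)$ in color $c_j$), where the colors $c_1,\ldots,c_n$ are pairwise distinct. -}

module Defs where

open import Data.Nat using (ℕ; zero; suc; _≤_; _<_)
open import Data.Fin using (Fin; zero; suc; inject₁; fromℕ)
open import Data.Fin.Subset using (Subset; _∈_; _∉_; _⊆_; _-_; ⊥)
open import Data.List using (length; filter; allFin)
open import Data.Product using (_×_; Σ; ∃; _,_)
open import Data.Empty using () renaming (⊥ to Empty)
open import Relation.Nullary using (¬_; Dec; yes; no)
open import Relation.Binary.PropositionalEquality using (_≡_; _≢_; refl; cong)
open import Relation.Binary.Construct.Closure.ReflexiveTransitive using (Star)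
open import Function.Definitions using (Injective)
import Data.Fin as F

-- Open shop system with n jobs and m machines M_1..M_m (indexed by Fin m)

record OpenShop (n m : ℕ) : Set where
  field
    jobs    : Fin n → Subset m
    cap     : Fin m → ℕ
    cap-pos : ∀ i → 1 ≤ cap i

-- Positions: M_0 (start), M_i for i : Fin m, M_{m+1} (end)
data Pos (m : ℕ) : Set where
  start : Pos m
  mach  : Fin m → Pos m
  end   : Pos m

_≟P_ : ∀ {m} (p q : Pos m) → Dec (p ≡ q)
start  ≟P start  = yes refl
start  ≟P mach _ = no λ ()
start  ≟P end    = no λ ()
mach _ ≟P start  = no λ ()
mach i ≟P mach j with i F.≟ j
... | yes refl = yes refl
... | no i≢j   = no λ { refl → i≢j refl }
mach _ ≟P end    = no λ ()
end    ≟P start  = no λ ()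
end    ≟P mach _ = no λ ()
end    ≟P end    = yes refl

-- A (pre)state: the position M^s(J_j) and the remaining set 𝓜^s(J_j) of every job
record State (n m : ℕ) : Set where
  constructor mkState
  field
    pos : Fin n → Pos m
    rem : Fin n → Subset m

module _ {n m : ℕ} (sys : OpenShop n m) where
  open OpenShop sys
  open State

  occupancy : State n m → Fin m → ℕ
  occupancy s i = length (filter (λ j → pos s j ≟P mach i) (allFin n))

  ValidState : State n m → Set
  ValidState s =
    (∀ j → rem s j ⊆ jobs j) ×
    (∀ j i → pos s j ≡ mach i → i ∉ rem s j) ×
    (∀ i → occupancy s i ≤ cap i)

  initial : State n m
  initial = mkState (λ _ → start) jobs

  IsFinal : State n m → Set
  IsFinal s = ∀ j → pos s j ≡ end × rem s j ≡ ⊥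

  moveTo : State n m → Fin n → Fin m → State n m
  moveTo s j i = mkState
    (λ j' → sel (j' F.≟ j) (mach i) (pos s j'))
    (λ j' → sel (j' F.≟ j) (rem s j - i) (rem s j'))
    where
      sel : ∀ {A : Set} {P : Set} → Dec P → A → A → A
      sel (yes _) a _ = a
      sel (no _)  _ b = b

  moveEnd : State n m → Fin n → State n m
  moveEnd s j = mkState
    (λ j' → sel (j' F.≟ j) end (pos s j'))
    (rem s)
    where
      sel : ∀ {A : Set} {P : Set} → Dec P → A → A → A
      sel (yes _) a _ = a
      sel (no _)  _ b = b

  data Step : State n m → State n m → Set where
    step-mach : ∀ s j i → i ∈ rem s j → occupancy s i < cap i →
                Step s (moveTo s j i)
    step-end  : ∀ s j → rem s j ≡ ⊥ → pos s j ≢ end →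
                Step s (moveEnd s j)

  Reachable : State n m → Set
  Reachable s = Star Step initial s

  Deadlock : State n m → Set
  Deadlock s = ValidState s × ¬ IsFinal s × (∀ s' → ¬ Step s s')

  CanReachDeadlock : Set
  CanReachDeadlock = ∃ λ s → Reachable s × Deadlock s

  Edge : Fin n → Fin m → Fin m → Set
  Edge j a b = a ≢ b × a ∈ jobs j × b ∈ jobs j

  record RainbowCycle : Set where
    field
      k        : ℕ
      k≥1      : 1 ≤ k
      vert     : Fin (suc k) → Fin m
      col      : Fin (suc k) → Fin n
      vert-inj : Injective _≡_ _≡_ vert
      col-inj  : Injective _≡_ _≡_ col
      edges    : ∀ (i : Fin k) → Edge (col (inject₁ i)) (vert (inject₁ i)) (vert (suc i))
      closing  : Edge (col (fromℕ k)) (vert (fromℕ k)) (vert zero)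

  HasRainbowCycle : Set
  HasRainbowCycle = RainbowCycle

-- (ii) ⇒ (i): in a non-final state without successor, every unfinished job still needs some
-- machine, and that machine is occupied (an empty machine would admit a move, as capacities are
-- positive). Following "the job on machine i still needs machine i′" gives an infinite walk in G
-- in which each colour is used only from the machine its job sits on; the stretch between the
-- first repeated machine and its repetition is a rainbow cycle. This direction needs no
-- assumption on the capacities.
--
-- (i) ⇒ (ii): for a rainbow cycle v₀ … v_k with colours c₀ … c_k, let each job c_u in turn visit
-- all its machines off the cycle (they are free) and then sit down on v_u. Afterwards every c_u
-- still needs its neighbour on the cycle, and only cycle machines, all occupied; with capacity 1
-- this persists under every step. Running the system until no step is possible (each step
-- decreases a potential) therefore ends in a deadlock.

module Submission where

open import Defs
open import Data.Nat using (ℕ; zero; suc; _+_; _*_; _≤_; _<_; z≤n; s≤s; s≤s⁻¹)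
open import Data.Nat.GeneralisedArithmetic using (fold)
open import Data.Nat.Induction using (<-wellFounded)
import Data.Nat.Properties as ℕ
open import Data.Fin using (Fin; zero; suc; toℕ; inject₁; fromℕ; fromℕ<)
import Data.Fin as Fin
import Data.Fin.Properties as Fin
open import Data.Fin.Subset using (Subset; _∈_; _∉_; _⊆_; _─_; _-_; ⊥; ∣_∣; Nonempty; inside; outside)
open import Data.Fin.Subset.Properties
  using (_∈?_; nonempty?; Empty-unique; ∉⊥; x∈⁅x⁆; p─q⊆p; x∈p∧x≢y⇒x∈p-y; x∈p⇒∣p-x∣<∣p∣)
import Data.Vec as Vec
open import Data.List using (List; []; _∷_; length; allFin)
open import Data.List.Properties using (filter-none)
open import Data.List.Relation.Unary.Any using (here; there)
open import Data.List.Relation.Unary.Any.Properties using (¬Any[])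
open import Data.List.Relation.Unary.All using (_∷_; lookup)
open import Data.List.Relation.Unary.All.Properties using (all-filter; tabulate⁺)
open import Data.List.Relation.Unary.AllPairs using (_∷_)
open import Data.List.Relation.Unary.Unique.Propositional using (Unique)
open import Data.List.Relation.Unary.Unique.Propositional.Properties using (allFin⁺; filter⁺)
import Data.List.Membership.Propositional as List
open import Data.List.Membership.Propositional.Properties using (∈-filter⁺; ∈-allFin; ∈-length)
open import Data.Product using (_×_; ∃; ∃₂; _,_; proj₁; proj₂; map₂)
open import Data.Sum using (_⊎_; inj₁; inj₂)
open import Data.Empty using (⊥-elim)
open import Function using (_∘_; id; _on_)
open import Induction.WellFounded using (Acc; acc)
open import Relation.Nullary using (¬_; yes; no; contradiction)
open import Relation.Nullary.Decidable using (_×-dec_; ¬?; decidable-stable)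
open import Relation.Unary using (Pred; Decidable)
open import Relation.Binary.PropositionalEquality
open import Relation.Binary.Construct.Closure.ReflexiveTransitive using (Star; ε; _◅_; _◅◅_)
import Relation.Binary.Construct.Closure.ReflexiveTransitive as Star
import Relation.Binary.Construct.On as On
open import Function.Bundles using (_⇔_; mk⇔)
open import Function.Definitions using (Injective)

x∈p─q⇒x∉q : ∀ {n} {p q : Subset n} {x} → x ∈ p ─ q → x ∉ q
x∈p─q⇒x∉q {p = inside Vec.∷ _} {q = outside Vec.∷ _} Vec.here ()
x∈p─q⇒x∉q {p = _ Vec.∷ _} {q = _ Vec.∷ _} (Vec.there x∈p─q) (Vec.there x∈q) = x∈p─q⇒x∉q x∈p─q x∈q

x∈p-y⇒x≢y : ∀ {n} {p : Subset n} {x y} → x ∈ p - y → x ≢ y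
x∈p-y⇒x≢y x∈p-y refl = x∈p─q⇒x∉q x∈p-y (x∈⁅x⁆ _)

unique∧constant⇒length≤1 : ∀ {a} {A : Set a} {xs : List A} → Unique xs →
                           (∀ {x y} → x List.∈ xs → y List.∈ xs → x ≡ y) → length xs ≤ 1
unique∧constant⇒length≤1 {xs = []}        _                 _    = z≤n
unique∧constant⇒length≤1 {xs = _ ∷ []}    _                 _    = s≤s z≤n
unique∧constant⇒length≤1 {xs = _ ∷ _ ∷ _} ((x≢y ∷ _) ∷ _) same = ⊥-elim (x≢y (same (here refl) (there (here refl))))

∑ : ∀ {k} → (Fin k → ℕ) → ℕ
∑ {zero}  f = 0
∑ {suc k} f = f zero + ∑ (f ∘ suc)

∑-mono-≤ : ∀ {k} {f g : Fin k → ℕ} → (∀ i → f i ≤ g i) → ∑ f ≤ ∑ g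
∑-mono-≤ {zero}  f≤g = z≤n
∑-mono-≤ {suc k} f≤g = ℕ.+-mono-≤ (f≤g zero) (∑-mono-≤ (f≤g ∘ suc))

∑-mono-< : ∀ {k} {f g : Fin k → ℕ} → (∀ i → f i ≤ g i) → ∀ j → f j < g j → ∑ f < ∑ g
∑-mono-< f≤g zero    fj<gj = ℕ.+-mono-<-≤ fj<gj (∑-mono-≤ (f≤g ∘ suc))
∑-mono-< f≤g (suc j) fj<gj = ℕ.+-mono-≤-< (f≤g zero) (∑-mono-< (f≤g ∘ suc) j fj<gj)

inject₁-or-fromℕ : ∀ {k} (u : Fin (suc k)) → (∃ λ i → u ≡ inject₁ i) ⊎ u ≡ fromℕ k
inject₁-or-fromℕ {zero}  zero    = inj₂ refl
inject₁-or-fromℕ {suc k} zero    = inj₁ (zero , refl)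
inject₁-or-fromℕ {suc k} (suc u) with inject₁-or-fromℕ u
... | inj₁ (i , refl) = inj₁ (suc i , refl)
... | inj₂ refl       = inj₂ refl

InjectiveBelow : ∀ {a} {A : Set a} → (ℕ → A) → ℕ → Set a
InjectiveBelow x b = ∀ {p q} → p < b → q < b → x p ≡ x q → p ≡ q

FirstRepetition : ∀ {a} {A : Set a} → (ℕ → A) → Set a
FirstRepetition x = ∃₂ λ a b → a < b × x a ≡ x b × InjectiveBelow x b

injectiveBelow-suc : ∀ {a} {A : Set a} {x : ℕ → A} {b} → InjectiveBelow x b →
                     (∀ {p} → p < b → x p ≢ x b) → InjectiveBelow x (suc b)
injectiveBelow-suc inj new {p} {q} p<1+b q<1+b xp≡xq
  with ℕ.m<1+n⇒m<n∨m≡n p<1+b | ℕ.m<1+n⇒m<n∨m≡n q<1+b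
... | inj₁ p<b  | inj₁ q<b  = inj p<b q<b xp≡xq
... | inj₁ p<b  | inj₂ refl = ⊥-elim (new p<b xp≡xq)
... | inj₂ refl | inj₁ q<b  = ⊥-elim (new q<b (sym xp≡xq))
... | inj₂ refl | inj₂ refl = refl

injectiveBelow⊎firstRepetition : ∀ {m} (x : ℕ → Fin m) b → InjectiveBelow x b ⊎ FirstRepetition x
injectiveBelow⊎firstRepetition x zero = inj₁ λ ()
injectiveBelow⊎firstRepetition x (suc b) with injectiveBelow⊎firstRepetition x b
... | inj₂ rep = inj₂ rep
... | inj₁ inj with Fin.any? (λ (a : Fin b) → x (toℕ a) Fin.≟ x b)
...   | yes (a , xa≡xb) = inj₂ (toℕ a , b , Fin.toℕ<n a , xa≡xb , inj)
...   | no  ¬rep        = inj₁ (injectiveBelow-suc inj λ p<b xp≡xb →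
                            ¬rep (fromℕ< p<b , subst (λ p → x p ≡ x b) (sym (Fin.toℕ-fromℕ< p<b)) xp≡xb))

firstRepetition : ∀ {m} (x : ℕ → Fin m) → FirstRepetition x
firstRepetition {m} x with injectiveBelow⊎firstRepetition x (suc m)
... | inj₂ rep = rep
... | inj₁ inj with Fin.pigeonhole (ℕ.n<1+n m) (x ∘ toℕ)
...   | i , j , i<j , xi≡xj = ⊥-elim (ℕ.<-irrefl (inj (Fin.toℕ<n i) (Fin.toℕ<n j) xi≡xj) i<j)

mach-injective : ∀ {m} {i i′ : Fin m} → Pos.mach i ≡ mach i′ → i ≡ i′
mach-injective refl = refl

-- Open shop systems with arbitrary capacities

module _ {n m : ℕ} (sys : OpenShop n m) where
  open OpenShop sys
  open State

  Vacant : State n m → Fin m → Set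
  Vacant s i = ∀ j → pos s j ≢ mach i

  Exclusive : State n m → Set
  Exclusive s = ∀ {i j j′} → pos s j ≡ mach i → pos s j′ ≡ mach i → j ≡ j′

  Terminal : State n m → Set
  Terminal s = ∀ s′ → ¬ Step sys s s′

  AgreeExcept : Fin n → State n m → State n m → Set
  AgreeExcept j s s′ = ∀ {j′} → j′ ≢ j → pos s j′ ≡ pos s′ j′ × rem s j′ ≡ rem s′ j′

  agreeExcept-trans : ∀ {j s₁ s₂ s₃} → AgreeExcept j s₁ s₂ → AgreeExcept j s₂ s₃ → AgreeExcept j s₁ s₃
  agreeExcept-trans a₁₂ a₂₃ j′≢j =
    trans (proj₁ (a₁₂ j′≢j)) (proj₁ (a₂₃ j′≢j)) , trans (proj₂ (a₁₂ j′≢j)) (proj₂ (a₂₃ j′≢j))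

  agreeExcept-∀ : ∀ {ℓ} (Q : Fin n → Pos m → Subset m → Set ℓ) {j s s′} → AgreeExcept j s s′ →
                  Q j (pos s′ j) (rem s′ j) → (∀ j′ → Q j′ (pos s j′) (rem s j′)) →
                  ∀ j′ → Q j′ (pos s′ j′) (rem s′ j′)
  agreeExcept-∀ Q {j} agree moved others j′ with j′ Fin.≟ j
  ... | yes refl = moved
  ... | no j′≢j  = subst₂ (Q j′) (proj₁ (agree j′≢j)) (proj₂ (agree j′≢j)) (others j′)

  moveTo-pos : ∀ s j i → pos (moveTo sys s j i) j ≡ mach i
  moveTo-pos s j i with j Fin.≟ j
  ... | yes _   = refl
  ... | no j≢j  = contradiction refl j≢j

  moveTo-rem : ∀ s j i → rem (moveTo sys s j i) j ≡ rem s j - i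
  moveTo-rem s j i with j Fin.≟ j
  ... | yes _   = refl
  ... | no j≢j  = contradiction refl j≢j

  moveTo-others : ∀ s j i → AgreeExcept j s (moveTo sys s j i)
  moveTo-others s j i {j′} j′≢j with j′ Fin.≟ j
  ... | yes j′≡j = contradiction j′≡j j′≢j
  ... | no _     = refl , refl

  moveEnd-pos : ∀ s j → pos (moveEnd sys s j) j ≡ end
  moveEnd-pos s j with j Fin.≟ j
  ... | yes _   = refl
  ... | no j≢j  = contradiction refl j≢j

  moveEnd-others : ∀ s j → AgreeExcept j s (moveEnd sys s j)
  moveEnd-others s j {j′} j′≢j with j′ Fin.≟ j
  ... | yes j′≡j = contradiction j′≡j j′≢j
  ... | no _     = refl , refl

  movedJob : ∀ {s s′} → Step sys s s′ → Fin n
  movedJob (step-mach _ j _ _ _) = j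
  movedJob (step-end _ j _ _)    = j

  step-others : ∀ {s s′} (st : Step sys s s′) → AgreeExcept (movedJob st) s s′
  step-others (step-mach s j i _ _) = moveTo-others s j i
  step-others (step-end s j _ _)    = moveEnd-others s j

  invariant* : ∀ {ℓ} (I : State n m → Set ℓ) → (∀ {s s′} → Step sys s s′ → I s → I s′) →
               ∀ {s s′} → Star (Step sys) s s′ → I s → I s′
  invariant* I preserved = Star.fold (λ s s′ → I s → I s′) (λ st k → k ∘ preserved st) id

  occupancy≡0 : ∀ s {i} → Vacant s i → occupancy sys s i ≡ 0
  occupancy≡0 s {i} vacant = cong length (filter-none (λ j → pos s j ≟P mach i) (tabulate⁺ vacant))

  occupancy>0 : ∀ s {i j} → pos s j ≡ mach i → 0 < occupancy sys s i
  occupancy>0 s {i} {j} seated = ∈-length (∈-filter⁺ (λ j → pos s j ≟P mach i) (∈-allFin j) seated)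

  occupancy≤1 : ∀ s {i} → Exclusive s → occupancy sys s i ≤ 1
  occupancy≤1 s {i} excl = unique∧constant⇒length≤1 (filter⁺ P? (allFin⁺ n))
    (λ x∈ y∈ → excl (lookup (all-filter P? (allFin n)) x∈) (lookup (all-filter P? (allFin n)) y∈))
    where
      P? : Decidable (λ j → pos s j ≡ mach i)
      P? j = pos s j ≟P mach i

  vacant⇒room : ∀ s {i} → Vacant s i → occupancy sys s i < cap i
  vacant⇒room s {i} vacant rewrite occupancy≡0 s {i} vacant = cap-pos i

  record JobWellFormed (j : Fin n) (p : Pos m) (r : Subset m) : Set where
    field
      remaining⊆jobs    : r ⊆ jobs j
      current∉remaining : ∀ {i} → p ≡ mach i → i ∉ r
      current∈jobs      : ∀ {i} → p ≡ mach i → i ∈ jobs j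
      finished          : p ≡ end → r ≡ ⊥

  WellFormed : State n m → Set
  WellFormed s = ∀ j → JobWellFormed j (pos s j) (rem s j)

  initial-wellFormed : WellFormed (initial sys)
  initial-wellFormed j = record
    { remaining⊆jobs = id ; current∉remaining = λ () ; current∈jobs = λ () ; finished = λ () }

  wellFormed-step : ∀ {s s′} → Step sys s s′ → WellFormed s → WellFormed s′
  wellFormed-step (step-mach s j i i∈r _) wf = agreeExcept-∀ JobWellFormed (moveTo-others s j i) moved wf
    where
      open JobWellFormed (wf j)
      moved : JobWellFormed j (pos (moveTo sys s j i) j) (rem (moveTo sys s j i) j)
      moved rewrite moveTo-pos s j i | moveTo-rem s j i = record
        { remaining⊆jobs    = remaining⊆jobs ∘ p─q⊆p _ _
        ; current∉remaining = λ { refl i∈r-i → x∈p-y⇒x≢y i∈r-i refl }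
        ; current∈jobs      = λ { refl → remaining⊆jobs i∈r }
        ; finished          = λ ()
        }
  wellFormed-step (step-end s j r≡⊥ _) wf = agreeExcept-∀ JobWellFormed (moveEnd-others s j) moved wf
    where
      open JobWellFormed (wf j)
      moved : JobWellFormed j (pos (moveEnd sys s j) j) (rem s j)
      moved rewrite moveEnd-pos s j = record
        { remaining⊆jobs = remaining⊆jobs ; current∉remaining = λ () ; current∈jobs = λ () ; finished = λ _ → r≡⊥ }

  reachable⇒wellFormed : ∀ {s} → Reachable sys s → WellFormed s
  reachable⇒wellFormed r = invariant* WellFormed wellFormed-step r initial-wellFormed

  pending : Pos m → ℕ
  pending end = 0
  pending _   = 1

  -- The factor 2 makes every step decrease the weight even in states that are not well formed,
  -- where a job at M_{m+1} may still move to a machine.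
  weight : Pos m → Subset m → ℕ
  weight p r = pending p + ∣ r ∣ * 2

  potential : State n m → ℕ
  potential s = ∑ λ j → weight (pos s j) (rem s j)

  moved-weight< : ∀ {s s′} (st : Step sys s s′) → let j = movedJob st in
                  weight (pos s′ j) (rem s′ j) < weight (pos s j) (rem s j)
  moved-weight< (step-mach s j i i∈r _) rewrite moveTo-pos s j i | moveTo-rem s j i =
    ℕ.≤-trans (ℕ.*-monoˡ-≤ 2 (x∈p⇒∣p-x∣<∣p∣ i∈r)) (ℕ.m≤n+m _ (pending (pos s j)))
  moved-weight< (step-end s j _ unfinished) rewrite moveEnd-pos s j with pos s j
  ... | start  = ℕ.≤-refl
  ... | mach _ = ℕ.≤-refl
  ... | end    = contradiction refl unfinished

  potential-step : ∀ {s s′} → Step sys s s′ → potential s′ < potential s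
  potential-step {s} {s′} st = ∑-mono-< weight≤ (movedJob st) (moved-weight< st)
    where
      weight≤ : ∀ j → weight (pos s′ j) (rem s′ j) ≤ weight (pos s j) (rem s j)
      weight≤ j with j Fin.≟ movedJob st
      ... | yes refl = ℕ.<⇒≤ (moved-weight< st)
      ... | no j≢j₀  =
        ℕ.≤-reflexive (sym (cong₂ weight (proj₁ (step-others st j≢j₀)) (proj₂ (step-others st j≢j₀))))

  step? : ∀ s → (∃ λ s′ → Step sys s s′) ⊎ Terminal s
  step? s with Fin.any? (λ j → Fin.any? (λ i → (i ∈? rem s j) ×-dec (occupancy sys s i ℕ.<? cap i)))
  ... | yes (j , i , i∈r , room) = inj₁ (_ , step-mach s j i i∈r room)
  ... | no ¬mach with Fin.any? (λ j → ¬? (nonempty? (rem s j)) ×-dec ¬? (pos s j ≟P end))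
  ...   | yes (j , empty , unfinished) = inj₁ (_ , step-end s j (Empty-unique empty) unfinished)
  ...   | no ¬end = inj₂ λ
            { _ (step-mach .s j i i∈r room)    → ¬mach (j , i , i∈r , room)
            ; _ (step-end .s j r≡⊥ unfinished) → ¬end (j , (λ (i , i∈r) → ∉⊥ (subst (i ∈_) r≡⊥ i∈r)) , unfinished)
            }

  terminal-reachable : ∀ s → ∃ λ s′ → Star (Step sys) s s′ × Terminal s′
  terminal-reachable s = go s (On.wellFounded potential <-wellFounded s)
    where
      go : ∀ s → Acc (_<_ on potential) s → ∃ λ s′ → Star (Step sys) s s′ × Terminal s′
      go s (acc rs) with step? s
      ... | inj₂ terminal  = s , ε , terminal
      ... | inj₁ (s₁ , st) with go s₁ (rs (potential-step st))
      ...   | s′ , path , terminal = s′ , st ◅ path , terminal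

  agreeExcept-exclusive : ∀ {j s s′} → AgreeExcept j s s′ → (∀ {i} → pos s′ j ≡ mach i → Vacant s i) →
                          Exclusive s → Exclusive s′
  agreeExcept-exclusive {j} agree target-vacant excl {i} {j₁} {j₂} e₁ e₂ with j₁ Fin.≟ j | j₂ Fin.≟ j
  ... | yes refl | yes refl = refl
  ... | yes refl | no j₂≢j  = contradiction (trans (proj₁ (agree j₂≢j)) e₂) (target-vacant e₁ j₂)
  ... | no j₁≢j  | yes refl = contradiction (trans (proj₁ (agree j₁≢j)) e₁) (target-vacant e₂ j₁)
  ... | no j₁≢j  | no j₂≢j  = excl (trans (proj₁ (agree j₁≢j)) e₁) (trans (proj₁ (agree j₂≢j)) e₂)

  record Tour {ℓ} (j : Fin n) (A : Pred (Fin m) ℓ) (s : State n m) : Set ℓ where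
    field
      tourEnd          : State n m
      tourPath         : Star (Step sys) s tourEnd
      othersStay       : AgreeExcept j s tourEnd
      remaining⊆A      : ∀ {i} → i ∈ rem tourEnd j → A i
      A-remaining-kept : ∀ {i} → i ∈ rem s j → A i → i ∈ rem tourEnd j

  tour : ∀ {ℓ} {j} {A : Pred (Fin m) ℓ} → Decidable A → (L : List (Fin m)) → ∀ {s} → WellFormed s →
         (∀ {j′ i} → j′ ≢ j → pos s j′ ≡ mach i → A i) →
         (∀ {i} → i ∈ rem s j → ¬ A i → i List.∈ L) → Tour j A s
  tour A? [] {s} _ _ covered = record
    { tourEnd = s ; tourPath = ε ; othersStay = λ _ → refl , refl
    ; remaining⊆A = λ {i} i∈r → decidable-stable (A? i) λ ¬Ai → ¬Any[] (covered i∈r ¬Ai)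
    ; A-remaining-kept = λ i∈r _ → i∈r }
  tour {j = j} {A} A? (i ∷ L) {s} wf others-in-A covered with (i ∈? rem s j) ×-dec ¬? (A? i)
  ... | no skip = tour A? L wf others-in-A covered′
    where
      covered′ : ∀ {i′} → i′ ∈ rem s j → ¬ A i′ → i′ List.∈ L
      covered′ i′∈r ¬Ai′ with covered i′∈r ¬Ai′
      ... | here refl  = contradiction (i′∈r , ¬Ai′) skip
      ... | there i′∈L = i′∈L
  ... | yes (i∈r , ¬Ai) = extend (tour A? L (wellFormed-step step wf) others-in-A′ covered′)
    where
      vacant : Vacant s i
      vacant j′ seated with j′ Fin.≟ j
      ... | yes refl = JobWellFormed.current∉remaining (wf j) seated i∈r
      ... | no j′≢j  = ¬Ai (others-in-A j′≢j seated)
      s₁ : State n m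
      s₁ = moveTo sys s j i
      step : Step sys s s₁
      step = step-mach s j i i∈r (vacant⇒room s vacant)
      others-in-A′ : ∀ {j′ i′} → j′ ≢ j → pos s₁ j′ ≡ mach i′ → A i′
      others-in-A′ j′≢j seated = others-in-A j′≢j (trans (proj₁ (moveTo-others s j i j′≢j)) seated)
      covered′ : ∀ {i′} → i′ ∈ rem s₁ j → ¬ A i′ → i′ List.∈ L
      covered′ {i′} i′∈r₁ ¬Ai′ with subst (i′ ∈_) (moveTo-rem s j i) i′∈r₁
      ... | i′∈r-i with covered (p─q⊆p _ _ i′∈r-i) ¬Ai′
      ...   | here refl  = contradiction refl (x∈p-y⇒x≢y i′∈r-i)
      ...   | there i′∈L = i′∈L
      extend : Tour j A s₁ → Tour j A s
      extend T = record
        { tourEnd = tourEnd ; tourPath = step ◅ tourPath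
        ; othersStay = agreeExcept-trans (moveTo-others s j i) othersStay
        ; remaining⊆A = remaining⊆A
        ; A-remaining-kept = λ {i′} i′∈r Ai′ → A-remaining-kept
            (subst (i′ ∈_) (sym (moveTo-rem s j i)) (x∈p∧x≢y⇒x∈p-y i′∈r λ { refl → ¬Ai Ai′ })) Ai′ }
        where open Tour T

  -- Deadlocks yield rainbow cycles

  walk⇒rainbowCycle : (x : ℕ → Fin m) (c : ℕ → Fin n) → (∀ t → Edge sys (c t) (x t) (x (suc t))) →
                      (∀ t t′ → c t ≡ c t′ → x t ≡ x t′) → RainbowCycle sys
  walk⇒rainbowCycle x c edge colour⇒vertex with firstRepetition x
  ... | a , b , a<b , xa≡xb , inj with ℕ.m≤n⇒∃[o]m+o≡n a<b
  ...   | zero  , refl = contradiction (trans xa≡xb (cong (x ∘ suc) (ℕ.+-identityʳ a))) (proj₁ (edge a))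
  ...   | suc k , refl = record
    { k = suc k ; k≥1 = s≤s z≤n ; vert = vert ; col = col ; vert-inj = vert-inj
    ; col-inj = vert-inj ∘ colour⇒vertex _ _ ; edges = edges ; closing = closing }
    where
      vert : Fin (suc (suc k)) → Fin m
      vert u = x (a + toℕ u)
      col : Fin (suc (suc k)) → Fin n
      col u = c (a + toℕ u)
      inWindow : ∀ u → a + toℕ u < suc (a + suc k)
      inWindow u = s≤s (ℕ.+-monoʳ-≤ a (s≤s⁻¹ (Fin.toℕ<n u)))
      vert-inj : Injective _≡_ _≡_ vert
      vert-inj {u} {v} e = Fin.toℕ-injective (ℕ.+-cancelˡ-≡ a _ _ (inj (inWindow u) (inWindow v) e))
      edges : ∀ i → Edge sys (col (inject₁ i)) (vert (inject₁ i)) (vert (suc i))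
      edges i rewrite Fin.toℕ-inject₁ i | ℕ.+-suc a (toℕ i) = edge (a + toℕ i)
      closing : Edge sys (col (fromℕ (suc k))) (vert (fromℕ (suc k))) (vert zero)
      closing rewrite Fin.toℕ-fromℕ (suc k) | ℕ.+-identityʳ a =
        subst (Edge sys (c (a + suc k)) (x (a + suc k))) (sym xa≡xb) (edge (a + suc k))

  module _ {s} (wf : WellFormed s) (terminal : Terminal s) where
    record Seat : Set where
      constructor seat
      field
        machine : Fin m
        job     : Fin n
        seated  : pos s job ≡ mach machine
    open Seat

    waiting : ∀ {j} → pos s j ≢ end → Nonempty (rem s j)
    waiting {j} unfinished with nonempty? (rem s j)
    ... | yes nonempty = nonempty
    ... | no  empty    = contradiction (step-end s j (Empty-unique empty) unfinished) (terminal _)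

    occupied : ∀ {i j} → i ∈ rem s j → ∃ λ j′ → pos s j′ ≡ mach i
    occupied {i} {j} i∈r with Fin.any? (λ j′ → pos s j′ ≟P mach i)
    ... | yes occupant = occupant
    ... | no  vacant   =
      contradiction (step-mach s j i i∈r (vacant⇒room s λ j′ seated → vacant (j′ , seated))) (terminal _)

    occupant : ∀ {i j} → i ∈ rem s j → Seat
    occupant {i} i∈r = seat i (proj₁ (occupied i∈r)) (proj₂ (occupied i∈r))

    awaited : (w : Seat) → Nonempty (rem s (job w))
    awaited w = waiting λ atEnd → mach≢end (trans (sym (seated w)) atEnd)
      where
        mach≢end : ∀ {i} → Pos.mach i ≢ end
        mach≢end ()

    next : Seat → Seat
    next w = occupant (proj₂ (awaited w))

    next-edge : ∀ w → Edge sys (job w) (machine w) (machine (next w))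
    next-edge w = (λ i≡i′ → current∉remaining (seated w) (subst (_∈ rem s (job w)) (sym i≡i′) i′∈r))
                , current∈jobs (seated w) , remaining⊆jobs i′∈r
      where
        open JobWellFormed (wf (job w))
        i′∈r : machine (next w) ∈ rem s (job w)
        i′∈r = proj₂ (awaited w)

    firstSeat : ¬ IsFinal sys s → Seat
    firstSeat notFinal with Fin.all? (λ j → pos s j ≟P end)
    ... | yes allEnd = contradiction (λ j → allEnd j , JobWellFormed.finished (wf j) (allEnd j)) notFinal
    ... | no  ¬allEnd with Fin.¬∀⟶∃¬ n _ (λ j → pos s j ≟P end) ¬allEnd
    ...   | _ , unfinished = occupant (proj₂ (waiting unfinished))

    terminal⇒rainbowCycle : ¬ IsFinal sys s → RainbowCycle sys
    terminal⇒rainbowCycle notFinal =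
      walk⇒rainbowCycle (machine ∘ walk) (job ∘ walk) (next-edge ∘ walk) colour⇒vertex
      where
        walk : ℕ → Seat
        walk = fold (firstSeat notFinal) next
        colour⇒vertex : ∀ t t′ → job (walk t) ≡ job (walk t′) → machine (walk t) ≡ machine (walk t′)
        colour⇒vertex t t′ same =
          mach-injective (trans (sym (seated (walk t))) (trans (cong (pos s) same) (seated (walk t′))))

module UnitCapacity {n m : ℕ} (sys : OpenShop n m) (cap≡1 : ∀ i → OpenShop.cap sys i ≡ 1) where
  open OpenShop sys
  open State

  room⇒vacant : ∀ s {i} → occupancy sys s i < cap i → Vacant sys s i
  room⇒vacant s {i} room j seated =
    ℕ.<-irrefl refl (ℕ.<-≤-trans (subst (occupancy sys s i <_) (cap≡1 i) room) (occupancy>0 sys s seated))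

  exclusive-step : ∀ {s s′} → Step sys s s′ → Exclusive sys s → Exclusive sys s′
  exclusive-step (step-mach s j i _ room) = agreeExcept-exclusive sys (moveTo-others sys s j i) λ seated →
    subst (Vacant sys s) (mach-injective (trans (sym (moveTo-pos sys s j i)) seated)) (room⇒vacant s room)
  exclusive-step (step-end s j _ _) = agreeExcept-exclusive sys (moveEnd-others sys s j) λ seated →
    contradiction (trans (sym (moveEnd-pos sys s j)) seated) λ ()

  reachable⇒valid : ∀ {s} → Reachable sys s → ValidState sys s
  reachable⇒valid {s} r =
      (λ j → JobWellFormed.remaining⊆jobs (wf j)) , (λ j i → JobWellFormed.current∉remaining (wf j)) ,
      λ i → subst (occupancy sys s i ≤_) (sym (cap≡1 i)) (occupancy≤1 sys s exclusive)
    where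
      wf : WellFormed sys s
      wf = reachable⇒wellFormed sys r
      exclusive : Exclusive sys s
      exclusive = invariant* sys (Exclusive sys) exclusive-step r λ ()

  -- Rainbow cycles yield deadlocks

  module _ (rc : RainbowCycle sys) where
    open RainbowCycle rc

    OnCycle : Fin m → Set
    OnCycle i = ∃ λ u → vert u ≡ i

    onCycle? : Decidable OnCycle
    onCycle? i = Fin.any? λ u → vert u Fin.≟ i

    outEdge : ∀ u → ∃ λ w → Edge sys (col u) (vert u) (vert w)
    outEdge u with inject₁-or-fromℕ u
    ... | inj₁ (i , refl) = suc i , edges i
    ... | inj₂ refl       = zero , closing

    record Seated (s : State n m) (u : Fin (suc k)) : Set where
      field
        seated       : pos s (col u) ≡ mach (vert u)
        waitsOnCycle : ∀ {i} → i ∈ rem s (col u) → OnCycle i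
        waits        : Nonempty (rem s (col u))
    open Seated

    seated-unmoved : ∀ {j s s′ u} → AgreeExcept sys j s s′ → j ≢ col u → Seated s u → Seated s′ u
    seated-unmoved {j} {s} {s′} {u} agree j≢ σ = record
      { seated       = trans (sym p≡) (seated σ)
      ; waitsOnCycle = λ {i} i∈r → waitsOnCycle σ (subst (i ∈_) (sym r≡) i∈r)
      ; waits        = map₂ (λ {i} → subst (i ∈_) r≡) (waits σ) }
      where
        p≡ : pos s (col u) ≡ pos s′ (col u)
        p≡ = proj₁ (agree (j≢ ∘ sym))
        r≡ : rem s (col u) ≡ rem s′ (col u)
        r≡ = proj₂ (agree (j≢ ∘ sym))

    Blocked : State n m → Set
    Blocked s = ∀ u → Seated s u

    blocked-step : ∀ {s s′} → Step sys s s′ → Blocked s → Blocked s′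
    blocked-step (step-mach s j i i∈r room) blocked u with j Fin.≟ col u
    ... | no  j≢   = seated-unmoved (moveTo-others sys s j i) j≢ (blocked u)
    ... | yes refl with waitsOnCycle (blocked u) i∈r
    ...   | w , refl = ⊥-elim (room⇒vacant s room (col w) (seated (blocked w)))
    blocked-step (step-end s j r≡⊥ _) blocked u with j Fin.≟ col u
    ... | no  j≢   = seated-unmoved (moveEnd-others sys s j) j≢ (blocked u)
    ... | yes refl with waits (blocked u)
    ...   | i , i∈r = ⊥-elim (∉⊥ (subst (i ∈_) r≡⊥ i∈r))

    blocked-deadlock : ∀ {s} → Reachable sys s → Terminal sys s → Blocked s → Deadlock sys s
    blocked-deadlock {s} r terminal blocked = reachable⇒valid r , notFinal , terminal
      where
        notFinal : ¬ IsFinal sys s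
        notFinal final = contradiction (trans (sym (seated (blocked zero))) (proj₁ (final (col zero)))) λ ()

    record Placement (t : ℕ) (s : State n m) : Set where
      field
        placed    : ∀ u → toℕ u < t → Seated s u
        untouched : ∀ j → (∀ u → toℕ u < t → j ≢ col u) → pos s j ≡ start × rem s j ≡ jobs j

    placement₀ : Placement 0 (initial sys)
    placement₀ = record { placed = λ _ () ; untouched = λ _ _ → refl , refl }

    placement-seat : ∀ {t s j i} → Placement t s → pos s j ≡ mach i → ∃ λ u → toℕ u < t × vert u ≡ i
    placement-seat {t} {s} {j} P seated-j with Fin.any? (λ u → (toℕ u ℕ.<? t) ×-dec (j Fin.≟ col u))
    ... | yes (u , u<t , refl) =
      u , u<t , mach-injective (trans (sym (seated (Placement.placed P u u<t))) seated-j)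
    ... | no  unplaced = contradiction
          (trans (sym (proj₁ (Placement.untouched P j λ u u<t j≡ → unplaced (u , u<t , j≡)))) seated-j) λ ()

    col-earlier≢ : ∀ {u u′} → toℕ u′ < toℕ u → col u ≢ col u′
    col-earlier≢ u′<u e = ℕ.<-irrefl (cong toℕ (sym (col-inj e))) u′<u

    placement-suc : ∀ {s s′} u → Placement (toℕ u) s → AgreeExcept sys (col u) s s′ → Seated s′ u →
                    Placement (suc (toℕ u)) s′
    placement-suc {s} {s′} u P others seated-u = record { placed = placed′ ; untouched = untouched′ }
      where
        open Placement P
        placed′ : ∀ u′ → toℕ u′ < suc (toℕ u) → Seated s′ u′
        placed′ u′ u′<1+u with ℕ.m<1+n⇒m<n∨m≡n u′<1+u
        ... | inj₂ u′≡u rewrite Fin.toℕ-injective u′≡u = seated-u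
        ... | inj₁ u′<u = seated-unmoved others (col-earlier≢ u′<u) (placed u′ u′<u)
        untouched′ : ∀ j → (∀ u′ → toℕ u′ < suc (toℕ u) → j ≢ col u′) → pos s′ j ≡ start × rem s′ j ≡ jobs j
        untouched′ j unplaced =
            trans (sym (proj₁ (others j≢))) (proj₁ old) , trans (sym (proj₂ (others j≢))) (proj₂ old)
          where
            j≢ : j ≢ col u
            j≢ = unplaced u (ℕ.n<1+n _)
            old : pos s j ≡ start × rem s j ≡ jobs j
            old = untouched j λ u′ u′<u → unplaced u′ (ℕ.m<n⇒m<1+n u′<u)

    place : ∀ {s} (u : Fin (suc k)) → Reachable sys s → Placement (toℕ u) s →
            ∃ λ s′ → Reachable sys s′ × Placement (suc (toℕ u)) s′
    place {s} u r P = s₂ , r ◅◅ tourPath ◅◅ step ◅ ε , placement-suc u P others seated-u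
      where
        fresh : pos s (col u) ≡ start × rem s (col u) ≡ jobs (col u)
        fresh = Placement.untouched P (col u) λ u′ → col-earlier≢
        T : Tour sys (col u) OnCycle s
        T = tour sys onCycle? (allFin m) (reachable⇒wellFormed sys r)
              (λ _ seated-j → map₂ proj₂ (placement-seat P seated-j)) (λ {i} _ _ → ∈-allFin i)
        open Tour T
        kept : ∀ {i} → i ∈ jobs (col u) → OnCycle i → i ∈ rem tourEnd (col u)
        kept {i} i∈J = A-remaining-kept (subst (i ∈_) (sym (proj₂ fresh)) i∈J)
        vert∈rem : vert u ∈ rem tourEnd (col u)
        vert∈rem = kept (proj₁ (proj₂ (proj₂ (outEdge u)))) (u , refl)
        vacant : Vacant sys tourEnd (vert u)
        vacant j seated-j with j Fin.≟ col u
        ... | yes refl =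
          JobWellFormed.current∉remaining (reachable⇒wellFormed sys (r ◅◅ tourPath) (col u)) seated-j vert∈rem
        ... | no  j≢ with placement-seat P (trans (proj₁ (othersStay j≢)) seated-j)
        ...   | w , w<u , vw≡vu = ℕ.<-irrefl (cong toℕ (vert-inj vw≡vu)) w<u
        s₂ : State n m
        s₂ = moveTo sys tourEnd (col u) (vert u)
        step : Step sys tourEnd s₂
        step = step-mach tourEnd (col u) (vert u) vert∈rem (vacant⇒room sys tourEnd vacant)
        others : AgreeExcept sys (col u) s s₂
        others = agreeExcept-trans sys othersStay (moveTo-others sys tourEnd (col u) (vert u))
        rem₂ : rem s₂ (col u) ≡ rem tourEnd (col u) - vert u
        rem₂ = moveTo-rem sys tourEnd (col u) (vert u)
        seated-u : Seated s₂ u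
        seated-u = record
          { seated       = moveTo-pos sys tourEnd (col u) (vert u)
          ; waitsOnCycle = λ {i} i∈r₂ → remaining⊆A (p─q⊆p _ _ (subst (i ∈_) rem₂ i∈r₂))
          ; waits        = vert w , subst (vert w ∈_) (sym rem₂)
                             (x∈p∧x≢y⇒x∈p-y (kept (proj₂ (proj₂ edge)) (w , refl)) (proj₁ edge ∘ sym)) }
          where
            w : Fin (suc k)
            w = proj₁ (outEdge u)
            edge : Edge sys (col u) (vert u) (vert w)
            edge = proj₂ (outEdge u)

    placements : ∀ t → t ≤ suc k → ∃ λ s → Reachable sys s × Placement t s
    placements zero    _      = initial sys , ε , placement₀
    placements (suc t) t<1+k with placements t (ℕ.<⇒≤ t<1+k)
    ... | s , r , P with place (fromℕ< t<1+k) r (subst (λ t → Placement t s) (sym (Fin.toℕ-fromℕ< t<1+k)) P)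
    ...   | s′ , r′ , P′ = s′ , r′ , subst (λ t → Placement (suc t) s′) (Fin.toℕ-fromℕ< t<1+k) P′

    rainbowCycle⇒deadlock : CanReachDeadlock sys
    rainbowCycle⇒deadlock with placements (suc k) ℕ.≤-refl
    ... | s , r , P with terminal-reachable sys s
    ...   | s′ , path , terminal = s′ , r ◅◅ path , blocked-deadlock (r ◅◅ path) terminal blocked
      where
        blocked : Blocked s′
        blocked = invariant* sys Blocked blocked-step path λ u → Placement.placed P u (Fin.toℕ<n u)

lemma8p1 : ∀ {n m : ℕ} (sys : OpenShop n m) →
    (∀ (i : Fin m) → OpenShop.cap sys i ≡ 1) →
    (HasRainbowCycle sys ⇔ CanReachDeadlock sys)
lemma8p1 sys cap≡1 = mk⇔ (UnitCapacity.rainbowCycle⇒deadlock sys cap≡1)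
  λ (s , r , _ , notFinal , terminal) → terminal⇒rainbowCycle sys (reachable⇒wellFormed sys r) terminal notFinal
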